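{- Each member of the family $\mathscr{F}_\infty$ and each member of the family $\mathscr{F}^\Delta_\infty$ contains an induced $\infty$-flower.
   Context: $F_\infty$ is the graph consisting of a vertex $u$, a ray $v_1v_2v_3\dots$ (the rim), and edges $uv_i$ for all $i\ge 1$. $\mathscr{F}_\infty$ is the family of all subdivisions of $F_\infty$. Replacing a vertex $v$ of degree $d\le3$ with neighbours $u_1,\dots,u_d$ by a triangle means deleting $v$, adding a triangle $v_1v_2v_3$ of new vertices and edges $u_iv_i$ for $1\le i\le d$. $\mathscr{F}^\Delta_\infty$ is the family of graphs obtained from $F_\infty$ by replacing every rim vertex by a triangle and then arbitrarily subdividing each edge not in such a triangle. An $\infty$-flower consists of countably infinitely many edge-disjoint induced cycles pairwise meeting only in one common vertex. -}

module Defs where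

open import Data.Nat using (ℕ; zero; suc)
open import Data.Fin using (Fin; toℕ; inject₁; fromℕ) renaming (zero to fz; suc to fs)
open import Data.Product using (Σ; _×_; _,_; proj₁; proj₂; ∃)
open import Data.Sum using (_⊎_; inj₁; inj₂)
open import Relation.Binary.PropositionalEquality using (_≡_; _≢_)
open import Relation.Nullary using (¬_)

record Graph : Set₁ where
  field
    V   : Set
    Adj : V → V → Set

record EdgeGraph : Set₁ where
  field
    V    : Set
    Ed   : Set
    ends : Ed → V × V

-- Along edge e with ends (a , b), position 0 is a, position ℓ e + 1 is b
-- and the k-th internal vertex (k < ℓ e) is at position k + 1.
module _ (B : EdgeGraph) (ℓ : EdgeGraph.Ed B → ℕ) where
  open EdgeGraph B

  SubV : Set
  SubV = V ⊎ Σ Ed (λ e → Fin (ℓ e))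

  at : SubV → Ed → ℕ → Set
  at (inj₁ v) e p =
    (p ≡ 0 × v ≡ proj₁ (ends e)) ⊎ (p ≡ suc (ℓ e) × v ≡ proj₂ (ends e))
  at (inj₂ (e' , k)) e p = e' ≡ e × p ≡ suc (toℕ k)

  SubAdj : SubV → SubV → Set
  SubAdj x y = Σ Ed λ e → Σ ℕ λ p →
    (at x e p × at y e (suc p)) ⊎ (at y e p × at x e (suc p))

  subdivide : Graph
  subdivide = record { V = SubV ; Adj = SubAdj }

-- The fan F∞ : hub u, rim ray v₀ v₁ v₂ …, spokes u vᵢ
-- (rim index i here corresponds to v_{i+1} in the paper)

data FV : Set where
  hub : FV
  rim : ℕ → FV

data FE : Set where
  spoke : ℕ → FE
  rimE  : ℕ → FE

F∞ : EdgeGraph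
F∞ = record { V = FV ; Ed = FE ; ends = endsF }
  where
  endsF : FE → FV × FV
  endsF (spoke i) = hub , rim i
  endsF (rimE i)  = rim i , rim (suc i)

-- A member of 𝓕∞ (up to isomorphism): subdivide every edge of F∞ arbitrarily.
SubdivF∞ : (FE → ℕ) → Graph
SubdivF∞ ℓ = subdivide F∞ ℓ

-- F∞ with every rim vertex replaced by a triangle.
-- Rim vertex vᵢ becomes the triangle tri i 0, tri i 1, tri i 2;
-- tri i 0 takes the spoke, tri i 1 the edge to vᵢ₊₁, tri i 2 the edge to vᵢ₋₁
-- (for the first rim vertex, of degree 2, tri 0 2 has no outside neighbour).

data TV : Set where
  thub : TV
  tri  : ℕ → Fin 3 → TV

data TNE : Set where
  tspoke : ℕ → TNE
  trimE  : ℕ → TNE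

data TE : Set where
  outer : TNE → TE
  triE  : ℕ → Fin 3 → TE

next3 : Fin 3 → Fin 3
next3 fz = fs fz
next3 (fs fz) = fs (fs fz)
next3 (fs (fs fz)) = fz

FΔbase : EdgeGraph
FΔbase = record { V = TV ; Ed = TE ; ends = endsT }
  where
  endsT : TE → TV × TV
  endsT (outer (tspoke i)) = thub , tri i fz
  endsT (outer (trimE i))  = tri i (fs fz) , tri (suc i) (fs (fs fz))
  endsT (triE i j)         = tri i j , tri i (next3 j)

extendLen : (TNE → ℕ) → TE → ℕ
extendLen ℓ (outer e)  = ℓ e
extendLen ℓ (triE _ _) = 0

SubdivFΔ∞ : (TNE → ℕ) → Graph
SubdivFΔ∞ ℓ = subdivide FΔbase (extendLen ℓ)

record Cycle (G : Graph) : Set where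
  open Graph G
  field
    k      : ℕ
    vert   : Fin (suc (suc (suc k))) → V
    inj    : ∀ i j → vert i ≡ vert j → i ≡ j
    adj    : ∀ (i : Fin (suc (suc k))) → Adj (vert (inject₁ i)) (vert (fs i))
    adjEnd : Adj (vert (fromℕ (suc (suc k)))) (vert fz)

  DirEdge : V → V → Set
  DirEdge x y =
    (Σ (Fin (suc (suc k))) λ i → x ≡ vert (inject₁ i) × y ≡ vert (fs i))
    ⊎ (x ≡ vert (fromℕ (suc (suc k))) × y ≡ vert fz)

  CycEdge : V → V → Set
  CycEdge x y = DirEdge x y ⊎ DirEdge y x

  _∈C : V → Set
  x ∈C = Σ (Fin (suc (suc (suc k)))) λ i → vert i ≡ x

-- An induced ∞-flower in G: countably many cycles Cₙ (n ∈ ℕ), each through a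
-- common vertex c, pairwise meeting only in c, such that the subgraph of G
-- induced on the union of their vertices has exactly the cycle edges
-- (hence each Cₙ is induced and the cycles are edge-disjoint).
record InducedFlower (G : Graph) : Set where
  open Graph G
  field
    centre  : V
    cyc     : ℕ → Cycle G
    through : ∀ n → Cycle._∈C (cyc n) centre
    meet    : ∀ n m → n ≢ m → ∀ x → Cycle._∈C (cyc n) x → Cycle._∈C (cyc m) x
              → x ≡ centre
    induced : ∀ n m x y → Cycle._∈C (cyc n) x → Cycle._∈C (cyc m) y → Adj x y
              → Σ ℕ λ j → Cycle.CycEdge (cyc j) x y

-- A cycle through the hub of a subdivided fan is the subdivision of a closed walk
-- hub → rim i → rim (i+1) → hub of the base graph; for 𝓕∞^Δ take instead the walk
-- hub → triangle 2n → triangle 2n+1 → hub. With i = 3n, consecutive walks are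
-- separated by an unused rim vertex (for 𝓕∞^Δ, by unused triangle corners), so the
-- cycles share only the hub, and every base edge joining two of their base vertices
-- is already an edge of one of the walks. Only unsubdivided base edges could be
-- chords, so the union of the cycles induces no further edge, whatever the
-- subdivision lengths are.
module Submission where

open import Defs
open import Data.Nat using (ℕ; zero; suc; _+_; _*_; _∸_; _≤_; _<_; z≤n; s≤s; s≤s⁻¹; z<s; s<s; NonZero)
open import Data.Nat.Properties
open import Data.Nat.DivMod using (_/_; _%_; +-distrib-/; m<n⇒m/n≡0; m*n/n≡m; m<n⇒m%n≡m; m*n%n≡0)
open import Data.Fin using (Fin; toℕ; fromℕ<) renaming (zero to fz; suc to fs)
open import Data.Fin.Properties using (toℕ-fromℕ<; fromℕ<-toℕ; toℕ<n; toℕ-injective; toℕ-inject₁; toℕ-fromℕ)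
open import Data.Product using (Σ; _×_; _,_; proj₁; proj₂)
open import Data.Sum using (_⊎_; inj₁; inj₂)
open import Function using (_∘_)
open import Data.Empty using (⊥-elim)
open import Data.List using (List; []; _∷_)
import Data.List as List
open import Data.List.Relation.Unary.Any using (here; there)
open import Data.List.Relation.Unary.All using ([]; _∷_)
import Data.List.Relation.Unary.All as All
open import Data.List.Relation.Unary.AllPairs using (AllPairs; []; _∷_)
open import Data.List.Membership.Propositional using (_∈_)
open import Relation.Binary.PropositionalEquality
open import Relation.Nullary using (yes; no; contradiction)

[r+m*n]/n≡m : ∀ r m n .{{_ : NonZero n}} → r < n → (r + m * n) / n ≡ m
[r+m*n]/n≡m r m n r<n = begin
  (r + m * n) / n    ≡⟨ +-distrib-/ r (m * n) remainders<n ⟩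
  r / n + m * n / n  ≡⟨ cong₂ _+_ (m<n⇒m/n≡0 r<n) (m*n/n≡m m n) ⟩
  m                  ∎
  where
  open ≡-Reasoning
  remainders<n : r % n + m * n % n < n
  remainders<n = subst₂ (λ a b → a + b < n) (sym (m<n⇒m%n≡m r<n)) (sym (m*n%n≡0 m n)) (subst (_< n) (sym (+-identityʳ r)) r<n)

r+m*n≡r′+m′*n⇒r≡r′ : ∀ {r r′} m m′ n .{{_ : NonZero n}} → r < n → r′ < n →
                     r + m * n ≡ r′ + m′ * n → r ≡ r′
r+m*n≡r′+m′*n⇒r≡r′ {r} {r′} m m′ n r<n r′<n eq = +-cancelʳ-≡ (m′ * n) r r′ (begin
  r + m′ * n  ≡⟨ cong (λ k → r + k * n) (sym quotients≡) ⟩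
  r + m * n   ≡⟨ eq ⟩
  r′ + m′ * n ∎)
  where
  open ≡-Reasoning
  quotients≡ : m ≡ m′
  quotients≡ = trans (sym ([r+m*n]/n≡m r m n r<n)) (trans (cong (_/ n) eq) ([r+m*n]/n≡m r′ m′ n r′<n))

data Orientation : Set where
  forward backward : Orientation

module Subdivision (B : EdgeGraph) (ℓ : EdgeGraph.Ed B → ℕ) where
  open EdgeGraph B

  source target : Ed → V
  source e = proj₁ (ends e)
  target e = proj₂ (ends e)

  inj₁-injective : ∀ {v w : V} → _≡_ {A = SubV B ℓ} (inj₁ v) (inj₁ w) → v ≡ w
  inj₁-injective refl = refl

  inj₂-injective : ∀ {e e′ : Ed} {k : Fin (ℓ e)} {k′ : Fin (ℓ e′)} →
                   _≡_ {A = SubV B ℓ} (inj₂ (e , k)) (inj₂ (e′ , k′)) → Σ (e ≡ e′) λ { refl → k ≡ k′ }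
  inj₂-injective refl = refl , refl

  inj₁≢inj₂ : ∀ {v x} → _≢_ {A = SubV B ℓ} (inj₁ v) (inj₂ x)
  inj₁≢inj₂ ()

  -- Positions beyond suc (ℓ e) are junk: they also give the target.
  point : Ed → ℕ → SubV B ℓ
  point e zero = inj₁ (source e)
  point e (suc q) with q <? ℓ e
  ... | yes q<ℓ = inj₂ (e , fromℕ< q<ℓ)
  ... | no  _   = inj₁ (target e)

  point-last : ∀ e → point e (suc (ℓ e)) ≡ inj₁ (target e)
  point-last e with ℓ e <? ℓ e
  ... | yes ℓ<ℓ = ⊥-elim (n≮n _ ℓ<ℓ)
  ... | no  _   = refl

  point-internal : ∀ e q → q < ℓ e → Σ (Fin (ℓ e)) λ k → point e (suc q) ≡ inj₂ (e , k) × toℕ k ≡ q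
  point-internal e q q<ℓ with q <? ℓ e
  ... | yes q<ℓ′ = fromℕ< q<ℓ′ , refl , toℕ-fromℕ< q<ℓ′
  ... | no  q≮ℓ  = ⊥-elim (q≮ℓ q<ℓ)

  at-point : ∀ e p → p ≤ suc (ℓ e) → at B ℓ (point e p) e p
  at-point e zero    _ = inj₁ (refl , refl)
  at-point e (suc q) p≤ with q <? ℓ e
  ... | yes q<ℓ = refl , cong suc (sym (toℕ-fromℕ< q<ℓ))
  ... | no  q≮ℓ = inj₂ (cong suc (≤-antisym (s≤s⁻¹ p≤) (≮⇒≥ q≮ℓ)) , refl)

  at⇒≡point : ∀ x e p → at B ℓ x e p → x ≡ point e p × p ≤ suc (ℓ e)
  at⇒≡point (inj₁ v) e p (inj₁ (refl , refl)) = refl , z≤n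
  at⇒≡point (inj₁ v) e p (inj₂ (refl , refl)) = sym (point-last e) , ≤-refl
  at⇒≡point (inj₂ (e′ , k)) e p (refl , refl) with toℕ k <? ℓ e
  ... | yes k<ℓ = cong (λ z → inj₂ (e , z)) (sym (fromℕ<-toℕ k k<ℓ)) , s≤s (<⇒≤ (toℕ<n k))
  ... | no  k≮ℓ = ⊥-elim (k≮ℓ (toℕ<n k))

  point-adj : ∀ e p → p ≤ ℓ e → SubAdj B ℓ (point e p) (point e (suc p))
  point-adj e p p≤ℓ = e , p , inj₁ (at-point e p (m≤n⇒m≤1+n p≤ℓ) , at-point e (suc p) (s≤s p≤ℓ))

  point-adj-reverse : ∀ e p → p ≤ ℓ e → SubAdj B ℓ (point e (suc p)) (point e p)
  point-adj-reverse e p p≤ℓ = e , p , inj₂ (at-point e p (m≤n⇒m≤1+n p≤ℓ) , at-point e (suc p) (s≤s p≤ℓ))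

  Dart : Set
  Dart = Ed × Orientation

  edge : Dart → Ed
  edge = proj₁

  tail head : Dart → V
  tail (e , forward)  = source e
  tail (e , backward) = target e
  head (e , forward)  = target e
  head (e , backward) = source e

  dartLength : Dart → ℕ
  dartLength d = suc (ℓ (edge d))

  dartPoint : Dart → ℕ → SubV B ℓ
  dartPoint (e , forward)  q = point e q
  dartPoint (e , backward) q = point e (suc (ℓ e) ∸ q)

  dartPoint-zero : ∀ d → dartPoint d 0 ≡ inj₁ (tail d)
  dartPoint-zero (e , forward)  = refl
  dartPoint-zero (e , backward) = point-last e

  dartPoint-last : ∀ d → dartPoint d (dartLength d) ≡ inj₁ (head d)
  dartPoint-last (e , forward)  = point-last e
  dartPoint-last (e , backward) = cong (point e) (n∸n≡0 (ℓ e))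

  dartPoint-adj : ∀ d q → q < dartLength d → SubAdj B ℓ (dartPoint d q) (dartPoint d (suc q))
  dartPoint-adj (e , forward)  q q<len = point-adj e q (s≤s⁻¹ q<len)
  dartPoint-adj (e , backward) q q<len =
    subst (λ p → SubAdj B ℓ (point e p) (point e (ℓ e ∸ q)))
          (sym (+-∸-assoc 1 (s≤s⁻¹ q<len)))
          (point-adj-reverse e (ℓ e ∸ q) (m∸n≤m (ℓ e) q))

  internalIndex : Dart → ℕ → ℕ
  internalIndex (e , forward)  r = r
  internalIndex (e , backward) r = ℓ e ∸ suc r

  internalIndex-injective : ∀ d {r r′} → r < ℓ (edge d) → r′ < ℓ (edge d) →
                            internalIndex d r ≡ internalIndex d r′ → r ≡ r′
  internalIndex-injective (e , forward)  _   _    eq = eq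
  internalIndex-injective (e , backward) r<ℓ r′<ℓ eq = suc-injective (∸-cancelˡ-≡ r<ℓ r′<ℓ eq)

  dartPoint-internal : ∀ d r → r < ℓ (edge d) → Σ (Fin (ℓ (edge d))) λ k →
                       dartPoint d (suc r) ≡ inj₂ (edge d , k) × toℕ k ≡ internalIndex d r
  dartPoint-internal (e , forward)  r r<ℓ = point-internal e r r<ℓ
  dartPoint-internal (e , backward) r r<ℓ
    with point-internal e (ℓ e ∸ suc r) (∸-monoʳ-< (s≤s z≤n) r<ℓ)
  ... | k , eq , k≡ = k , trans (cong (point e) (+-∸-assoc 1 r<ℓ)) eq , k≡

  dartPoint-tail⊎internal : ∀ d q → q < dartLength d →
                            dartPoint d q ≡ inj₁ (tail d) ⊎ Σ (Fin (ℓ (edge d))) λ k → dartPoint d q ≡ inj₂ (edge d , k)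
  dartPoint-tail⊎internal d zero    _     = inj₁ (dartPoint-zero d)
  dartPoint-tail⊎internal d (suc r) r<len with dartPoint-internal d r (s≤s⁻¹ r<len)
  ... | k , eq , _ = inj₂ (k , eq)

  dartPoint-injective : ∀ d q q′ → q < dartLength d → q′ < dartLength d → dartPoint d q ≡ dartPoint d q′ → q ≡ q′
  dartPoint-injective d zero zero _ _ _ = refl
  dartPoint-injective d zero (suc r′) _ r′<len eq with dartPoint-internal d r′ (s≤s⁻¹ r′<len)
  ... | _ , eq′ , _ = ⊥-elim (inj₁≢inj₂ (trans (sym (dartPoint-zero d)) (trans eq eq′)))
  dartPoint-injective d (suc r) zero r<len _ eq with dartPoint-internal d r (s≤s⁻¹ r<len)
  ... | _ , eq′ , _ = ⊥-elim (inj₁≢inj₂ (trans (sym (dartPoint-zero d)) (trans (sym eq) eq′)))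
  dartPoint-injective d (suc r) (suc r′) r<len r′<len eq
    with dartPoint-internal d r (s≤s⁻¹ r<len) | dartPoint-internal d r′ (s≤s⁻¹ r′<len)
  ... | k , eq₁ , k≡ | k′ , eq₂ , k′≡ with inj₂-injective (trans (sym eq₁) (trans eq eq₂))
  ... | refl , refl = cong suc (internalIndex-injective d (s≤s⁻¹ r<len) (s≤s⁻¹ r′<len) (trans (sym k≡) k′≡))

  Disjoint : Dart → Dart → Set
  Disjoint d d′ = ∀ q q′ → q < dartLength d → q′ < dartLength d′ → dartPoint d q ≢ dartPoint d′ q′

  distinct⇒Disjoint : ∀ d d′ → tail d ≢ tail d′ → edge d ≢ edge d′ → Disjoint d d′
  distinct⇒Disjoint d d′ tails≢ edges≢ q q′ q< q′< eq
    with dartPoint-tail⊎internal d q q< | dartPoint-tail⊎internal d′ q′ q′<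
  ... | inj₁ a       | inj₁ b        = tails≢ (inj₁-injective (trans (sym a) (trans eq b)))
  ... | inj₁ a       | inj₂ (_ , b)  = inj₁≢inj₂ (trans (sym a) (trans eq b))
  ... | inj₂ (_ , a) | inj₁ b        = inj₁≢inj₂ (trans (sym b) (trans (sym eq) a))
  ... | inj₂ (_ , a) | inj₂ (_ , b)  = edges≢ (proj₁ (inj₂-injective (trans (sym a) (trans eq b))))

  walkPoint : Dart → List Dart → ℕ → SubV B ℓ
  walkPoint d []        q = dartPoint d q
  walkPoint d (d′ ∷ ds) q with q <? dartLength d
  ... | yes _ = dartPoint d q
  ... | no  _ = walkPoint d′ ds (q ∸ dartLength d)

  walkLength : Dart → List Dart → ℕ
  walkLength d []        = dartLength d
  walkLength d (d′ ∷ ds) = dartLength d + walkLength d′ ds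

  dartLength≤walkLength : ∀ d ds → dartLength d ≤ walkLength d ds
  dartLength≤walkLength d []        = ≤-refl
  dartLength≤walkLength d (d′ ∷ ds) = m≤m+n (dartLength d) _

  #darts≤walkLength : ∀ d ds → List.length (d ∷ ds) ≤ walkLength d ds
  #darts≤walkLength d []        = s≤s z≤n
  #darts≤walkLength d (d′ ∷ ds) = +-mono-≤ (s≤s z≤n) (#darts≤walkLength d′ ds)


  walkPoint-zero : ∀ d ds → walkPoint d ds 0 ≡ inj₁ (tail d)
  walkPoint-zero d []        = dartPoint-zero d
  walkPoint-zero d (d′ ∷ ds) with 0 <? dartLength d
  ... | yes _  = dartPoint-zero d
  ... | no  0≮ = ⊥-elim (0≮ (s≤s z≤n))

  walkPoint-skip : ∀ d d′ ds q → walkPoint d (d′ ∷ ds) (dartLength d + q) ≡ walkPoint d′ ds q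
  walkPoint-skip d d′ ds q with dartLength d + q <? dartLength d
  ... | yes lt = ⊥-elim (m+n≮m (dartLength d) q lt)
  ... | no  _  = cong (walkPoint d′ ds) (m+n∸m≡n (dartLength d) q)

  private
    shift< : ∀ a p b → p < a + b → a ≤ p → p ∸ a < b
    shift< a p b p< a≤p = subst (p ∸ a <_) (m+n∸m≡n a b) (∸-monoˡ-< p< a≤p)

  walkPoint⇒dartPoint : ∀ d ds p → p < walkLength d ds →
                        Σ Dart λ d″ → d″ ∈ (d ∷ ds) × Σ ℕ λ q → q < dartLength d″ × walkPoint d ds p ≡ dartPoint d″ q
  walkPoint⇒dartPoint d [] p p< = d , here refl , p , p< , refl
  walkPoint⇒dartPoint d (d′ ∷ ds) p p< with p <? dartLength d
  ... | yes p<len = d , here refl , p , p<len , refl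
  ... | no  p≮len with walkPoint⇒dartPoint d′ ds (p ∸ dartLength d) (shift< (dartLength d) p _ p< (≮⇒≥ p≮len))
  ...   | d″ , d″∈ , q , q< , eq = d″ , there d″∈ , q , q< , eq

  walkPoint-injective : ∀ d ds → AllPairs Disjoint (d ∷ ds) → ∀ p p′ → p < walkLength d ds → p′ < walkLength d ds →
                        walkPoint d ds p ≡ walkPoint d ds p′ → p ≡ p′
  walkPoint-injective d [] _ p p′ p< p′< eq = dartPoint-injective d p p′ p< p′< eq
  walkPoint-injective d (d′ ∷ ds) (d-disjoint ∷ disjoint′) p p′ p< p′< eq with p <? dartLength d | p′ <? dartLength d
  ... | yes p<len | yes p′<len = dartPoint-injective d p p′ p<len p′<len eq
  ... | yes p<len | no  p′≮len with walkPoint⇒dartPoint d′ ds _ (shift< (dartLength d) p′ _ p′< (≮⇒≥ p′≮len))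
  ...   | d″ , d″∈ , q , q< , eq′ = ⊥-elim (All.lookup d-disjoint d″∈ p q p<len q< (trans eq eq′))
  walkPoint-injective d (d′ ∷ ds) (d-disjoint ∷ disjoint′) p p′ p< p′< eq | no p≮len | yes p′<len
    with walkPoint⇒dartPoint d′ ds _ (shift< (dartLength d) p _ p< (≮⇒≥ p≮len))
  ... | d″ , d″∈ , q , q< , eq′ = ⊥-elim (All.lookup d-disjoint d″∈ p′ q p′<len q< (trans (sym eq) eq′))
  walkPoint-injective d (d′ ∷ ds) (d-disjoint ∷ disjoint′) p p′ p< p′< eq | no p≮len | no p′≮len = begin
    p                                  ≡⟨ m+[n∸m]≡n (≮⇒≥ p≮len) ⟨
    dartLength d + (p ∸ dartLength d)  ≡⟨ cong (dartLength d +_) remainders≡ ⟩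
    dartLength d + (p′ ∸ dartLength d) ≡⟨ m+[n∸m]≡n (≮⇒≥ p′≮len) ⟩
    p′                                 ∎
    where
    open ≡-Reasoning
    remainders≡ : p ∸ dartLength d ≡ p′ ∸ dartLength d
    remainders≡ = walkPoint-injective d′ ds disjoint′ _ _ (shift< (dartLength d) p _ p< (≮⇒≥ p≮len))
                                                         (shift< (dartLength d) p′ _ p′< (≮⇒≥ p′≮len)) eq

  ReturnsTo : V → Dart → List Dart → Set
  ReturnsTo v d []        = head d ≡ v
  ReturnsTo v d (d′ ∷ ds) = head d ≡ tail d′ × ReturnsTo v d′ ds

  dartPoint-last≡walkPoint-zero : ∀ d d′ ds → head d ≡ tail d′ → dartPoint d (dartLength d) ≡ walkPoint d′ ds 0
  dartPoint-last≡walkPoint-zero d d′ ds joined =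
    trans (dartPoint-last d) (trans (cong inj₁ joined) (sym (walkPoint-zero d′ ds)))

  walkPoint-end : ∀ {v} d ds → ReturnsTo v d ds → walkPoint d ds (walkLength d ds) ≡ inj₁ v
  walkPoint-end d []        returns       = trans (dartPoint-last d) (cong inj₁ returns)
  walkPoint-end d (d′ ∷ ds) (_ , returns) = trans (walkPoint-skip d d′ ds _) (walkPoint-end d′ ds returns)

  walkPoint-first : ∀ {v} d ds → ReturnsTo v d ds → ∀ q → q ≤ dartLength d → walkPoint d ds q ≡ dartPoint d q
  walkPoint-first d []        _            q _  = refl
  walkPoint-first d (d′ ∷ ds) (joined , _) q q≤ with q <? dartLength d
  ... | yes _  = refl
  ... | no  q≮ = begin
    walkPoint d′ ds (q ∸ dartLength d)  ≡⟨ cong (walkPoint d′ ds) (m≤n⇒m∸n≡0 q≤) ⟩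
    walkPoint d′ ds 0                   ≡⟨ dartPoint-last≡walkPoint-zero d d′ ds joined ⟨
    dartPoint d (dartLength d)          ≡⟨ cong (dartPoint d) (≤-antisym q≤ (≮⇒≥ q≮)) ⟨
    dartPoint d q                       ∎
    where open ≡-Reasoning

  walkPoint-adj : ∀ {v} d ds → ReturnsTo v d ds → ∀ p → suc p ≤ walkLength d ds →
                  SubAdj B ℓ (walkPoint d ds p) (walkPoint d ds (suc p))
  walkPoint-adj d [] _ p p< = dartPoint-adj d p p<
  walkPoint-adj d (d′ ∷ ds) (joined , returns) p p< with p <? dartLength d | suc p <? dartLength d
  ... | yes p<len | yes _   = dartPoint-adj d p p<len
  ... | yes p<len | no  sp≮ = subst (SubAdj B ℓ (dartPoint d p)) across (dartPoint-adj d p p<len)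
    where
    sp≡len : suc p ≡ dartLength d
    sp≡len = ≤-antisym p<len (≮⇒≥ sp≮)
    across : dartPoint d (suc p) ≡ walkPoint d′ ds (suc p ∸ dartLength d)
    across = begin
      dartPoint d (suc p)                     ≡⟨ cong (dartPoint d) sp≡len ⟩
      dartPoint d (dartLength d)              ≡⟨ dartPoint-last≡walkPoint-zero d d′ ds joined ⟩
      walkPoint d′ ds 0                       ≡⟨ cong (walkPoint d′ ds) (m≤n⇒m∸n≡0 p<len) ⟨
      walkPoint d′ ds (suc p ∸ dartLength d)  ∎
      where open ≡-Reasoning
  ... | no p≮len | yes sp<len = ⊥-elim (p≮len (<⇒≤ sp<len))
  ... | no p≮len | no  _      =
    subst (SubAdj B ℓ (walkPoint d′ ds (p ∸ dartLength d))) (cong (walkPoint d′ ds) (sym shift-suc))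
          (walkPoint-adj d′ ds returns (p ∸ dartLength d)
            (subst (_≤ walkLength d′ ds) shift-suc (≤-trans (∸-monoˡ-≤ (dartLength d) p<) (≤-reflexive (m+n∸m≡n (dartLength d) _)))))
    where
    shift-suc : suc p ∸ dartLength d ≡ suc (p ∸ dartLength d)
    shift-suc = +-∸-assoc 1 (≮⇒≥ p≮len)

  dartStep⇒walkStep : ∀ {v} d ds → ReturnsTo v d ds → ∀ {d″} → d″ ∈ (d ∷ ds) → ∀ q → q < dartLength d″ →
                      Σ ℕ λ p → suc p ≤ walkLength d ds × walkPoint d ds p ≡ dartPoint d″ q
                                × walkPoint d ds (suc p) ≡ dartPoint d″ (suc q)
  dartStep⇒walkStep d ds returns (here refl) q q< =
    q , ≤-trans q< (dartLength≤walkLength d ds) , walkPoint-first d ds returns q (<⇒≤ q<) , walkPoint-first d ds returns (suc q) q<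
  dartStep⇒walkStep d (d′ ∷ ds) (_ , returns) (there d″∈) q q<
    with dartStep⇒walkStep d′ ds returns d″∈ q q<
  ... | p , sp≤ , eq₁ , eq₂ =
    dartLength d + p , subst (_≤ walkLength d (d′ ∷ ds)) (+-suc (dartLength d) p) (+-monoʳ-≤ (dartLength d) sp≤) ,
    trans (walkPoint-skip d d′ ds p) eq₁ ,
    trans (cong (walkPoint d (d′ ∷ ds)) (sym (+-suc (dartLength d) p))) (trans (walkPoint-skip d d′ ds (suc p)) eq₂)

  subdivision : Graph
  subdivision = subdivide B ℓ

  record CyclicWalk : Set where
    field
      first    : Dart
      rest     : List Dart
      returns  : ReturnsTo (tail first) first rest
      disjoint : AllPairs Disjoint (first ∷ rest)
      3≤length : 3 ≤ walkLength first rest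

    darts : List Dart
    darts = first ∷ rest

    private
      k : ℕ
      k = walkLength first rest ∸ 3

      3+k≡length : 3 + k ≡ walkLength first rest
      3+k≡length = m+[n∸m]≡n 3≤length

      vertex : Fin (3 + k) → SubV B ℓ
      vertex i = walkPoint first rest (toℕ i)

      vertex< : (i : Fin (3 + k)) → toℕ i < walkLength first rest
      vertex< i = subst (toℕ i <_) 3+k≡length (toℕ<n i)

      end≡start : walkPoint first rest (walkLength first rest) ≡ walkPoint first rest 0
      end≡start = trans (walkPoint-end first rest returns) (sym (walkPoint-zero first rest))

    cycle : Cycle subdivision
    cycle = record
      { k      = k
      ; vert   = vertex
      ; inj    = λ i j eq → toℕ-injective (walkPoint-injective first rest disjoint _ _ (vertex< i) (vertex< j) eq)
      ; adj    = λ i → subst (λ p → SubAdj B ℓ (walkPoint first rest p) (vertex (fs i))) (sym (toℕ-inject₁ i))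
                             (walkPoint-adj first rest returns (toℕ i) (<⇒≤ (vertex< (fs i))))
      ; adjEnd = subst₂ (SubAdj B ℓ) (cong (walkPoint first rest) (sym (toℕ-fromℕ (2 + k))))
                        (trans (cong (walkPoint first rest) 3+k≡length) end≡start)
                        (walkPoint-adj first rest returns (2 + k) (≤-reflexive 3+k≡length))
      }

    ∈cycle⇒tail⊎internal : ∀ x → Cycle._∈C cycle x →
                           Σ Dart λ d → d ∈ darts × (x ≡ inj₁ (tail d) ⊎ Σ (Fin (ℓ (edge d))) λ i → x ≡ inj₂ (edge d , i))
    ∈cycle⇒tail⊎internal x (i , refl) with walkPoint⇒dartPoint first rest (toℕ i) (vertex< i)
    ... | d , d∈ , q , q< , eq with dartPoint-tail⊎internal d q q<
    ...   | inj₁ tail≡     = d , d∈ , inj₁ (trans eq tail≡)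
    ...   | inj₂ (j , int≡) = d , d∈ , inj₂ (j , trans eq int≡)

    dartStep⇒cycleEdge : ∀ {d} → d ∈ darts → ∀ q → q < dartLength d → Cycle.DirEdge cycle (dartPoint d q) (dartPoint d (suc q))
    dartStep⇒cycleEdge d∈ q q< with dartStep⇒walkStep first rest returns d∈ q q<
    ... | p , sp≤ , eq₁ , eq₂ with suc p <? walkLength first rest
    ...   | yes sp< = inj₁ (i , trans (sym eq₁) (cong (walkPoint first rest) (sym (trans (toℕ-inject₁ i) toℕ-i)))
                              , trans (sym eq₂) (cong (λ j → walkPoint first rest (suc j)) (sym toℕ-i)))
      where
      p<2+k : p < 2 + k
      p<2+k = s≤s⁻¹ (subst (suc p <_) (sym 3+k≡length) sp<)
      i : Fin (2 + k)
      i = fromℕ< p<2+k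
      toℕ-i : toℕ i ≡ p
      toℕ-i = toℕ-fromℕ< p<2+k
    ...   | no  sp≮ = inj₂ (trans (sym eq₁) (cong (walkPoint first rest) (sym (trans (toℕ-fromℕ (2 + k)) p≡2+k)))
                            , trans (sym eq₂) (trans (cong (walkPoint first rest) sp≡length) end≡start))
      where
      sp≡length : suc p ≡ walkLength first rest
      sp≡length = ≤-antisym sp≤ (≮⇒≥ sp≮)
      p≡2+k : 2 + k ≡ p
      p≡2+k = suc-injective (trans 3+k≡length (sym sp≡length))

  open CyclicWalk public using (darts; cycle)

  UsedBy : (ℕ → CyclicWalk) → Ed → Set
  UsedBy walk e = Σ ℕ λ j → Σ Dart λ d → d ∈ darts (walk j) × edge d ≡ e

  -- The owners certify that distinct walks share no edge and no vertex except the centre.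
  record FlowerPattern : Set where
    field
      centre              : V
      walk                : ℕ → CyclicWalk
      walk-starts         : ∀ n → tail (CyclicWalk.first (walk n)) ≡ centre
      edgeOwner           : Ed → ℕ
      edgeOwner-correct   : ∀ n {d} → d ∈ darts (walk n) → edgeOwner (edge d) ≡ n
      vertexOwner         : V → ℕ
      vertexOwner-correct : ∀ n {d} → d ∈ darts (walk n) → tail d ≡ centre ⊎ vertexOwner (tail d) ≡ n
      chords-used         : ∀ e n m {d d′} → ℓ e ≡ 0 → d ∈ darts (walk n) → d′ ∈ darts (walk m) →
                            source e ≡ tail d → target e ≡ tail d′ → UsedBy walk e

  module _ (P : FlowerPattern) where
    open FlowerPattern P

    _∈cycle_ : SubV B ℓ → ℕ → Set
    x ∈cycle n = Cycle._∈C (cycle (walk n)) x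

    internal⇒used : ∀ n {e i} → inj₂ (e , i) ∈cycle n → UsedBy walk e
    internal⇒used n x∈ with CyclicWalk.∈cycle⇒tail⊎internal (walk n) _ x∈
    ... | d , d∈ , inj₁ eq       = ⊥-elim (inj₁≢inj₂ (sym eq))
    ... | d , d∈ , inj₂ (_ , eq) = n , d , d∈ , sym (proj₁ (inj₂-injective eq))

    base⇒tail : ∀ n {v} → inj₁ v ∈cycle n → Σ Dart λ d → d ∈ darts (walk n) × v ≡ tail d
    base⇒tail n x∈ with CyclicWalk.∈cycle⇒tail⊎internal (walk n) _ x∈
    ... | d , d∈ , inj₁ eq       = d , d∈ , inj₁-injective eq
    ... | d , d∈ , inj₂ (_ , eq) = ⊥-elim (inj₁≢inj₂ eq)

    consecutive⇒used : ∀ n m {x y} e p → x ∈cycle n → y ∈cycle m → x ≡ point e p → y ≡ point e (suc p) → p ≤ ℓ e →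
                UsedBy walk e
    consecutive⇒used n m e p x∈ y∈ x≡ y≡ p≤ with ℓ e ≤? p
    ... | no ℓ≰p with point-internal e p (≰⇒> ℓ≰p)
    ...   | _ , int≡ , _ = internal⇒used m (subst (_∈cycle m) (trans y≡ int≡) y∈)
    consecutive⇒used n m e (suc p) x∈ y∈ x≡ y≡ p≤ | yes ℓ≤p with point-internal e p p≤
    ...   | _ , int≡ , _ = internal⇒used n (subst (_∈cycle n) (trans x≡ int≡) x∈)
    consecutive⇒used n m e zero x∈ y∈ x≡ y≡ p≤ | yes ℓ≤0 with base⇒tail n (subst (_∈cycle n) x≡ x∈)
                                                  | base⇒tail m (subst (_∈cycle m) (trans y≡ target≡) y∈)
      where
      target≡ : point e 1 ≡ inj₁ (target e)
      target≡ = subst (λ l → point e (suc l) ≡ inj₁ (target e)) (n≤0⇒n≡0 ℓ≤0) (point-last e)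
    ... | d , d∈ , source≡ | d′ , d′∈ , target≡ = chords-used e n m (n≤0⇒n≡0 ℓ≤0) d∈ d′∈ source≡ target≡

    used⇒cycleEdge : ∀ {e} → (u : UsedBy walk e) → ∀ p → p ≤ ℓ e →
                     Cycle.CycEdge (cycle (walk (proj₁ u))) (point e p) (point e (suc p))
    used⇒cycleEdge (j , (e , forward) , d∈ , refl) p p≤ =
      inj₁ (CyclicWalk.dartStep⇒cycleEdge (walk j) d∈ p (s≤s p≤))
    used⇒cycleEdge (j , (e , backward) , d∈ , refl) p p≤ =
      inj₂ (subst₂ (Cycle.DirEdge (cycle (walk j))) suc-p≡ p≡
                   (CyclicWalk.dartStep⇒cycleEdge (walk j) d∈ (ℓ e ∸ p) (s≤s (m∸n≤m (ℓ e) p))))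
      where
      p≡ : point e (ℓ e ∸ (ℓ e ∸ p)) ≡ point e p
      p≡ = cong (point e) (m∸[m∸n]≡n p≤)
      suc-p≡ : point e (suc (ℓ e) ∸ (ℓ e ∸ p)) ≡ point e (suc p)
      suc-p≡ = trans (cong (point e) (+-∸-assoc 1 (m∸n≤m (ℓ e) p))) (cong (point e ∘ suc) (m∸[m∸n]≡n p≤))

    adjacent⇒cycleEdge : ∀ n m {x y} e p → x ∈cycle n → y ∈cycle m → at B ℓ x e p → at B ℓ y e (suc p) →
                         Σ ℕ λ j → Cycle.CycEdge (cycle (walk j)) x y
    adjacent⇒cycleEdge n m e p x∈ y∈ x-at y-at with at⇒≡point _ e p x-at | at⇒≡point _ e (suc p) y-at
    ... | x≡ , _ | y≡ , sp≤ = proj₁ used , subst₂ (Cycle.CycEdge (cycle (walk (proj₁ used)))) (sym x≡) (sym y≡)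
                                                  (used⇒cycleEdge used p (s≤s⁻¹ sp≤))
      where
      used : UsedBy walk e
      used = consecutive⇒used n m e p x∈ y∈ x≡ y≡ (s≤s⁻¹ sp≤)

    cycles-meet-at-centre : ∀ n m → n ≢ m → ∀ x → x ∈cycle n → x ∈cycle m → x ≡ inj₁ centre
    cycles-meet-at-centre n m n≢m x x∈n x∈m
      with CyclicWalk.∈cycle⇒tail⊎internal (walk n) x x∈n | CyclicWalk.∈cycle⇒tail⊎internal (walk m) x x∈m
    ... | d , d∈ , inj₁ x≡ | d′ , d′∈ , inj₁ x≡′ with vertexOwner-correct n d∈ | vertexOwner-correct m d′∈
    ...   | inj₁ centre≡ | _             = trans x≡ (cong inj₁ centre≡)
    ...   | _            | inj₁ centre≡′ = trans x≡′ (cong inj₁ centre≡′)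
    ...   | inj₂ owner≡  | inj₂ owner≡′  =
      ⊥-elim (n≢m (trans (sym owner≡) (trans (cong vertexOwner (inj₁-injective (trans (sym x≡) x≡′))) owner≡′)))
    cycles-meet-at-centre n m n≢m x x∈n x∈m | _ , _ , inj₁ x≡ | _ , _ , inj₂ (_ , x≡′) =
      ⊥-elim (inj₁≢inj₂ (trans (sym x≡) x≡′))
    cycles-meet-at-centre n m n≢m x x∈n x∈m | _ , _ , inj₂ (_ , x≡) | _ , _ , inj₁ x≡′ =
      ⊥-elim (inj₁≢inj₂ (trans (sym x≡′) x≡))
    cycles-meet-at-centre n m n≢m x x∈n x∈m | d , d∈ , inj₂ (_ , x≡) | d′ , d′∈ , inj₂ (_ , x≡′) =
      ⊥-elim (n≢m (trans (sym (edgeOwner-correct n d∈))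
                         (trans (cong edgeOwner (proj₁ (inj₂-injective (trans (sym x≡) x≡′)))) (edgeOwner-correct m d′∈))))

    inducedFlower : InducedFlower subdivision
    inducedFlower = record
      { centre  = inj₁ centre
      ; cyc     = λ n → cycle (walk n)
      ; through = λ n → fz , trans (walkPoint-zero (CyclicWalk.first (walk n)) (CyclicWalk.rest (walk n)))
                                         (cong inj₁ (walk-starts n))
      ; meet    = cycles-meet-at-centre
      ; induced = induced
      }
      where
      induced : ∀ n m x y → x ∈cycle n → y ∈cycle m → SubAdj B ℓ x y → Σ ℕ λ j → Cycle.CycEdge (cycle (walk j)) x y
      induced n m x y x∈ y∈ (e , p , inj₁ (x-at , y-at)) = adjacent⇒cycleEdge n m e p x∈ y∈ x-at y-at
      induced n m x y x∈ y∈ (e , p , inj₂ (y-at , x-at)) with adjacent⇒cycleEdge m n e p y∈ x∈ y-at x-at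
      ... | j , inj₁ yx = j , inj₂ yx
      ... | j , inj₂ xy = j , inj₁ xy

pattern dart₁ = here refl
pattern dart₂ = there (here refl)
pattern dart₃ = there (there (here refl))
pattern dart₄ = there (there (there (here refl)))
pattern dart₅ = there (there (there (there (here refl))))

module FanFlower (ℓ : FE → ℕ) where
  open Subdivision F∞ ℓ

  rim-injective : ∀ {i j} → rim i ≡ rim j → i ≡ j
  rim-injective refl = refl

  spoke-injective : ∀ {i j} → spoke i ≡ spoke j → i ≡ j
  spoke-injective refl = refl

  walk : ℕ → CyclicWalk
  walk n = record
    { first    = d₁
    ; rest     = d₂ ∷ d₃ ∷ []
    ; returns  = refl , refl , refl
    ; disjoint = (distinct⇒Disjoint d₁ d₂ (λ ()) (λ ())
                  ∷ distinct⇒Disjoint d₁ d₃ (λ ()) (λ eq → 1+n≢n (sym (spoke-injective eq))) ∷ [])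
               ∷ (distinct⇒Disjoint d₂ d₃ (λ eq → 1+n≢n (sym (rim-injective eq))) (λ ()) ∷ [])
               ∷ [] ∷ []
    ; 3≤length = #darts≤walkLength d₁ (d₂ ∷ d₃ ∷ [])
    }
    where
    d₁ d₂ d₃ : Dart
    d₁ = spoke (n * 3) , forward
    d₂ = rimE (n * 3) , forward
    d₃ = spoke (1 + n * 3) , backward

  edgeOwner : FE → ℕ
  edgeOwner (spoke i) = i / 3
  edgeOwner (rimE i)  = i / 3

  edgeOwner-correct : ∀ n {d} → d ∈ darts (walk n) → edgeOwner (edge d) ≡ n
  edgeOwner-correct n dart₁ = [r+m*n]/n≡m 0 n 3 z<s
  edgeOwner-correct n dart₂ = [r+m*n]/n≡m 0 n 3 z<s
  edgeOwner-correct n dart₃ = [r+m*n]/n≡m 1 n 3 (s<s z<s)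

  vertexOwner : FV → ℕ
  vertexOwner hub     = 0
  vertexOwner (rim i) = i / 3

  vertexOwner-correct : ∀ n {d} → d ∈ darts (walk n) → tail d ≡ hub ⊎ vertexOwner (tail d) ≡ n
  vertexOwner-correct n dart₁ = inj₁ refl
  vertexOwner-correct n dart₂ = inj₂ ([r+m*n]/n≡m 0 n 3 z<s)
  vertexOwner-correct n dart₃ = inj₂ ([r+m*n]/n≡m 1 n 3 (s<s z<s))

  chords-used : ∀ e n m {d d′} → ℓ e ≡ 0 → d ∈ darts (walk n) → d′ ∈ darts (walk m) →
                source e ≡ tail d → target e ≡ tail d′ → UsedBy walk e
  chords-used (spoke i) n m _ _ dart₁ _ ()
  chords-used (spoke i) n m _ _ dart₂ _ refl = m , _ , dart₁ , refl
  chords-used (spoke i) n m _ _ dart₃ _ refl = m , _ , dart₃ , refl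
  chords-used (rimE i)  n m _ dart₁ _ () _
  chords-used (rimE i)  n m _ dart₂ _ refl _ = n , _ , dart₂ , refl
  chords-used (rimE i)  n m _ dart₃ dart₁ refl ()
  chords-used (rimE i)  n m _ dart₃ dart₂ refl eq =
    contradiction (r+m*n≡r′+m′*n⇒r≡r′ n m 3 (s<s (s<s z<s)) z<s (rim-injective eq)) λ ()
  chords-used (rimE i)  n m _ dart₃ dart₃ refl eq =
    contradiction (r+m*n≡r′+m′*n⇒r≡r′ n m 3 (s<s (s<s z<s)) (s<s z<s) (rim-injective eq)) λ ()

  flowerPattern : FlowerPattern
  flowerPattern = record
    { centre              = hub
    ; walk                = walk
    ; walk-starts         = λ _ → refl
    ; edgeOwner           = edgeOwner
    ; edgeOwner-correct   = edgeOwner-correct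
    ; vertexOwner         = vertexOwner
    ; vertexOwner-correct = vertexOwner-correct
    ; chords-used         = chords-used
    }

module TriangleFanFlower (ℓ₀ : TNE → ℕ) where
  open Subdivision FΔbase (extendLen ℓ₀)

  tri-injective : ∀ {i j a b} → tri i a ≡ tri j b → i ≡ j
  tri-injective refl = refl

  tspoke-injective : ∀ {i j} → _≡_ {A = TE} (outer (tspoke i)) (outer (tspoke j)) → i ≡ j
  tspoke-injective refl = refl

  walk : ℕ → CyclicWalk
  walk n = record
    { first    = d₁
    ; rest     = d₂ ∷ d₃ ∷ d₄ ∷ d₅ ∷ []
    ; returns  = refl , refl , refl , refl , refl
    ; disjoint = (distinct⇒Disjoint d₁ d₂ (λ ()) (λ ()) ∷ distinct⇒Disjoint d₁ d₃ (λ ()) (λ ())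
                  ∷ distinct⇒Disjoint d₁ d₄ (λ ()) (λ ())
                  ∷ distinct⇒Disjoint d₁ d₅ (λ ()) (λ eq → 1+n≢n (sym (tspoke-injective eq))) ∷ [])
               ∷ (distinct⇒Disjoint d₂ d₃ (λ ()) (λ ()) ∷ distinct⇒Disjoint d₂ d₄ (λ ()) (λ ())
                  ∷ distinct⇒Disjoint d₂ d₅ (λ eq → 1+n≢n (sym (tri-injective eq))) (λ ()) ∷ [])
               ∷ (distinct⇒Disjoint d₃ d₄ (λ ()) (λ ()) ∷ distinct⇒Disjoint d₃ d₅ (λ ()) (λ ()) ∷ [])
               ∷ (distinct⇒Disjoint d₄ d₅ (λ ()) (λ ()) ∷ [])
               ∷ [] ∷ []
    ; 3≤length = ≤-trans (s≤s (s≤s (s≤s z≤n))) (#darts≤walkLength d₁ (d₂ ∷ d₃ ∷ d₄ ∷ d₅ ∷ []))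
    }
    where
    d₁ d₂ d₃ d₄ d₅ : Dart
    d₁ = outer (tspoke (n * 2)) , forward
    d₂ = triE (n * 2) fz , forward
    d₃ = outer (trimE (n * 2)) , forward
    d₄ = triE (1 + n * 2) (fs (fs fz)) , forward
    d₅ = outer (tspoke (1 + n * 2)) , backward

  edgeOwner : TE → ℕ
  edgeOwner (outer (tspoke i)) = i / 2
  edgeOwner (outer (trimE i))  = i / 2
  edgeOwner (triE i _)         = i / 2

  edgeOwner-correct : ∀ n {d} → d ∈ darts (walk n) → edgeOwner (edge d) ≡ n
  edgeOwner-correct n dart₁ = [r+m*n]/n≡m 0 n 2 z<s
  edgeOwner-correct n dart₂ = [r+m*n]/n≡m 0 n 2 z<s
  edgeOwner-correct n dart₃ = [r+m*n]/n≡m 0 n 2 z<s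
  edgeOwner-correct n dart₄ = [r+m*n]/n≡m 1 n 2 (s<s z<s)
  edgeOwner-correct n dart₅ = [r+m*n]/n≡m 1 n 2 (s<s z<s)

  vertexOwner : TV → ℕ
  vertexOwner thub      = 0
  vertexOwner (tri i _) = i / 2

  vertexOwner-correct : ∀ n {d} → d ∈ darts (walk n) → tail d ≡ thub ⊎ vertexOwner (tail d) ≡ n
  vertexOwner-correct n dart₁ = inj₁ refl
  vertexOwner-correct n dart₂ = inj₂ ([r+m*n]/n≡m 0 n 2 z<s)
  vertexOwner-correct n dart₃ = inj₂ ([r+m*n]/n≡m 0 n 2 z<s)
  vertexOwner-correct n dart₄ = inj₂ ([r+m*n]/n≡m 1 n 2 (s<s z<s))
  vertexOwner-correct n dart₅ = inj₂ ([r+m*n]/n≡m 1 n 2 (s<s z<s))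

  chords-used : ∀ e n m {d d′} → extendLen ℓ₀ e ≡ 0 → d ∈ darts (walk n) → d′ ∈ darts (walk m) →
                source e ≡ tail d → target e ≡ tail d′ → UsedBy walk e
  chords-used (outer (tspoke i)) n m _ _ dart₁ _ ()
  chords-used (outer (tspoke i)) n m _ _ dart₂ _ refl = m , _ , dart₁ , refl
  chords-used (outer (tspoke i)) n m _ _ dart₃ _ ()
  chords-used (outer (tspoke i)) n m _ _ dart₄ _ ()
  chords-used (outer (tspoke i)) n m _ _ dart₅ _ refl = m , _ , dart₅ , refl
  chords-used (outer (trimE i))  n m _ dart₁ _ () _
  chords-used (outer (trimE i))  n m _ dart₂ _ () _
  chords-used (outer (trimE i))  n m _ dart₃ _ refl _ = n , _ , dart₃ , refl
  chords-used (outer (trimE i))  n m _ dart₄ _ () _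
  chords-used (outer (trimE i))  n m _ dart₅ _ () _
  chords-used (triE i fz) n m _ _ dart₁ _ ()
  chords-used (triE i fz) n m _ _ dart₂ _ ()
  chords-used (triE i fz) n m _ _ dart₃ _ refl = m , _ , dart₂ , refl
  chords-used (triE i fz) n m _ _ dart₄ _ ()
  chords-used (triE i fz) n m _ _ dart₅ _ ()
  chords-used (triE i (fs fz)) n m _ dart₁ _ () _
  chords-used (triE i (fs fz)) n m _ dart₂ _ () _
  chords-used (triE i (fs fz)) n m _ dart₃ dart₁ refl ()
  chords-used (triE i (fs fz)) n m _ dart₃ dart₂ refl ()
  chords-used (triE i (fs fz)) n m _ dart₃ dart₃ refl ()
  chords-used (triE i (fs fz)) n m _ dart₃ dart₄ refl eq =
    contradiction (r+m*n≡r′+m′*n⇒r≡r′ n m 2 z<s (s<s z<s) (tri-injective eq)) λ ()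
  chords-used (triE i (fs fz)) n m _ dart₃ dart₅ refl ()
  chords-used (triE i (fs fz)) n m _ dart₄ _ () _
  chords-used (triE i (fs fz)) n m _ dart₅ _ () _
  chords-used (triE i (fs (fs fz))) n m _ dart₁ _ () _
  chords-used (triE i (fs (fs fz))) n m _ dart₂ _ () _
  chords-used (triE i (fs (fs fz))) n m _ dart₃ _ () _
  chords-used (triE i (fs (fs fz))) n m _ dart₄ _ refl _ = n , _ , dart₄ , refl
  chords-used (triE i (fs (fs fz))) n m _ dart₅ _ () _

  flowerPattern : FlowerPattern
  flowerPattern = record
    { centre              = thub
    ; walk                = walk
    ; walk-starts         = λ _ → refl
    ; edgeOwner           = edgeOwner
    ; edgeOwner-correct   = edgeOwner-correct
    ; vertexOwner         = vertexOwner
    ; vertexOwner-correct = vertexOwner-correct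
    ; chords-used         = chords-used
    }

lemma3p2 : ((ℓ : FE → ℕ) → InducedFlower (SubdivF∞ ℓ))
           × ((ℓ : TNE → ℕ) → InducedFlower (SubdivFΔ∞ ℓ))
lemma3p2 = (λ ℓ → Subdivision.inducedFlower F∞ ℓ (FanFlower.flowerPattern ℓ))
         , (λ ℓ → Subdivision.inducedFlower FΔbase (extendLen ℓ) (TriangleFanFlower.flowerPattern ℓ))
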